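{- Let $m\ge3$. Every node $F_m(\mathbf x)=\sum_{i=1}^k a_iP_m(x_i)$ of the escalator tree of $m$-gonal forms represents every positive integer up to $\sum_{i=1}^k a_i$.
   Context: For $x\in\mathbb Z$, $P_m(x)=\frac{m-2}{2}x^2-\frac{m-4}{2}x$. An $m$-gonal form of rank $n$ is $\sum_{i=1}^n a_iP_m(x_i)$ with positive integers $a_1\le\cdots\le a_n$; it represents a positive integer $N$ if it takes the value $N$ at some $\mathbf x\in\mathbb Z^n$, and is universal if it represents every positive integer. The truant of a non-universal form is the smallest positive integer it does not represent. The escalator tree is the rooted tree whose root is the empty form (rank $0$, truant $1$); if a node $\sum_{i=1}^k a_iP_m(x_i)$ is not universal with truant $T$, its children are all forms $\sum_{i=1}^{k+1}a_iP_m(x_i)$ with $a_{k+1}\ge a_k$ (any $a_1\ge1$ if $k=0$) representing $T$; universal nodes have no children (leaves). -}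

module Defs where

open import Data.Nat as ℕ using (ℕ; zero; suc; _≤_; _<_)
open import Data.Integer as ℤ using (ℤ; +_; _-_; _/ℕ_)
open import Data.List using (List; []; _∷_; _++_; [_]; length)
open import Data.Vec using (Vec; []; _∷_)
open import Data.Product using (Σ; _×_)
open import Relation.Binary.PropositionalEquality using (_≡_)
open import Relation.Nullary using (¬_)

-- P_m(x) = ((m-2)/2) x^2 - ((m-4)/2) x = ((m-2) x^2 - (m-4) x) / 2
-- (the numerator is always even, so the division by 2 is exact)
P : ℕ → ℤ → ℤ
P m x = (((+ m ℤ.- + 2) ℤ.* (x ℤ.* x)) ℤ.- ((+ m ℤ.- + 4) ℤ.* x)) /ℕ 2

formValue : ℕ → (as : List ℕ) → Vec ℤ (length as) → ℤ
formValue m [] [] = + 0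
formValue m (a ∷ as) (x ∷ xs) = + a ℤ.* P m x ℤ.+ formValue m as xs

Represents : ℕ → List ℕ → ℕ → Set
Represents m as N = Σ (Vec ℤ (length as)) λ x → formValue m as x ≡ + N

IsTruant : ℕ → List ℕ → ℕ → Set
IsTruant m as T =
  (1 ≤ T) × (¬ Represents m as T) × (∀ n → 1 ≤ n → n < T → Represents m as n)

AdmissibleNext : List ℕ → ℕ → Set
AdmissibleNext [] a = 1 ≤ a
AdmissibleNext (b ∷ []) a = b ≤ a
AdmissibleNext (b ∷ c ∷ bs) a = AdmissibleNext (c ∷ bs) a

data EscalatorNode (m : ℕ) : List ℕ → Set where
  root  : EscalatorNode m []
  child : ∀ {as a T} → EscalatorNode m as → IsTruant m as T →
          AdmissibleNext as a → Represents m (as ++ [ a ]) T →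
          EscalatorNode m (as ++ [ a ])

-- For m ≥ 3 every value of P_m is a natural number, and P_m(0) = 0, P_m(1) = 1.
-- Induct along the tree.  At a child F + a P_m of a node F with truant T, the
-- integers below T come from F (with the new variable 0) and T itself is
-- represented by definition.  Since T is not represented by F, writing
-- T = F(x) + a P_m(y) forces P_m(y) ≥ 1, so a ≤ T; hence every N with
-- T < N ≤ sum + a has N - a ≤ sum, which F represents by induction, and
-- N = (N - a) + a P_m(1).
module Submission where

open import Data.Nat as ℕ using (ℕ; zero; suc; _+_; _*_; _∸_; _≤_; _<_; z≤n; s≤s)
open import Data.Nat.Properties
  using (<-cmp; <⇒≤; ≤-trans; m≤m*n; m≤n+m; m≤n+o⇒m∸n≤o; m∸n+n≡m; +-identityʳ; *-zeroʳ; *-identityʳ; +-comm; module ≤-Reasoning)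
open import Data.Nat.ListAction using (sum)
open import Data.Nat.ListAction.Properties using (sum-++)
open import Data.Integer as ℤ using (ℤ; +_; -[1+_])
open import Data.Integer.Properties as ℤP using (pos-*)
open import Data.Integer.Solver using (module +-*-Solver)
open import Data.List using (List; []; _∷_; _++_; [_]; length)
open import Data.Vec using (Vec; []; _∷_)
open import Data.Product using (Σ-syntax; ∃; ∃₂; _×_; _,_)
open import Data.Empty using (⊥-elim)
open import Relation.Binary using (tri<; tri≈; tri>)
open import Relation.Binary.PropositionalEquality using (_≡_; refl; sym; trans; cong; cong₂; subst; module ≡-Reasoning)
open import Relation.Nullary using (¬_)
open import Defs

open +-*-Solver

-- P m x is P-numerator m x /ℕ 2 by definition.
P-numerator : ℕ → ℤ → ℤ
P-numerator m x = ((+ m ℤ.- + 2) ℤ.* (x ℤ.* x)) ℤ.- ((+ m ℤ.- + 4) ℤ.* x)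

-- With m = 3 + t the numerator is x ((m-2)(x-1) + 2) for x ≥ 0 and
-- |x| ((m-2)(|x|-1) + 2(m-3)) for x < 0, a product of natural numbers.
P-numerator-positive : ∀ t j → P-numerator (3 + t) (+ suc j) ≡ + suc j ℤ.* (+ suc t ℤ.* + j ℤ.+ + 2 ℤ.* + 1)
P-numerator-positive t j = solve 2
  (λ T J → ((con (+ 3) :+ T :- con (+ 2)) :* ((con (+ 1) :+ J) :* (con (+ 1) :+ J)))
           :- ((con (+ 3) :+ T :- con (+ 4)) :* (con (+ 1) :+ J))
        := (con (+ 1) :+ J) :* ((con (+ 1) :+ T) :* J :+ con (+ 2) :* con (+ 1)))
  refl (+ t) (+ j)

P-numerator-negative : ∀ t j → P-numerator (3 + t) -[1+ j ] ≡ + suc j ℤ.* (+ suc t ℤ.* + j ℤ.+ + 2 ℤ.* + t)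
P-numerator-negative t j = solve 2
  (λ T J → ((con (+ 3) :+ T :- con (+ 2)) :* ((:- (con (+ 1) :+ J)) :* (:- (con (+ 1) :+ J))))
           :- ((con (+ 3) :+ T :- con (+ 4)) :* (:- (con (+ 1) :+ J)))
        := (con (+ 1) :+ J) :* ((con (+ 1) :+ T) :* J :+ con (+ 2) :* T))
  refl (+ t) (+ j)

P-numerator-zero : ∀ m → P-numerator m (+ 0) ≡ + 0
P-numerator-zero m = solve 1
  (λ M → ((M :- con (+ 2)) :* (con (+ 0) :* con (+ 0))) :- ((M :- con (+ 4)) :* con (+ 0)) := con (+ 0))
  refl (+ m)

pos-*-+-* : ∀ a b c d e → + a ℤ.* (+ b ℤ.* + c ℤ.+ + d ℤ.* + e) ≡ + (a * (b * c + d * e))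
pos-*-+-* a b c d e = begin
  + a ℤ.* (+ b ℤ.* + c ℤ.+ + d ℤ.* + e) ≡⟨ cong (ℤ._*_ (+ a)) (cong₂ ℤ._+_ (sym (pos-* b c)) (sym (pos-* d e))) ⟩
  + a ℤ.* + (b * c + d * e)             ≡⟨ sym (pos-* a _) ⟩
  + (a * (b * c + d * e))               ∎
  where open ≡-Reasoning

P-numerator-natural : ∀ t x → ∃ λ k → P-numerator (3 + t) x ≡ + k
P-numerator-natural t (+ zero) = 0 , P-numerator-zero (3 + t)
P-numerator-natural t (+ suc j) = _ , trans (P-numerator-positive t j) (pos-*-+-* (suc j) (suc t) j 2 1)
P-numerator-natural t -[1+ j ]  = _ , trans (P-numerator-negative t j) (pos-*-+-* (suc j) (suc t) j 2 t)

P-natural : ∀ {m} → 3 ≤ m → ∀ x → ∃ λ k → P m x ≡ + k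
P-natural {suc (suc (suc t))} (s≤s (s≤s (s≤s _))) x with P-numerator-natural t x
... | k , eq = k ℕ./ 2 , cong (ℤ._/ℕ 2) eq

P-zero : ∀ m → P m (+ 0) ≡ + 0
P-zero m = cong (ℤ._/ℕ 2) (P-numerator-zero m)

P-one : ∀ m → P m (+ 1) ≡ + 1
P-one m = cong (ℤ._/ℕ 2) (solve 1
  (λ M → ((M :- con (+ 2)) :* (con (+ 1) :* con (+ 1))) :- ((M :- con (+ 4)) :* con (+ 1)) := con (+ 2))
  refl (+ m))

pos-+-* : ∀ r a k → + r ℤ.+ + a ℤ.* + k ≡ + (r + a * k)
pos-+-* r a k = cong (ℤ._+_ (+ r)) (sym (pos-* a k))

formValue-natural : ∀ {m} → 3 ≤ m → ∀ as xs → ∃ λ r → formValue m as xs ≡ + r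
formValue-natural m≥3 [] [] = 0 , refl
formValue-natural m≥3 (a ∷ as) (x ∷ xs) with P-natural m≥3 x | formValue-natural m≥3 as xs
... | k , Px≡k | r , xs↦r =
  a * k + r , trans (cong₂ (λ u v → + a ℤ.* u ℤ.+ v) Px≡k xs↦r) (cong (ℤ._+ + r) (sym (pos-* a k)))

formValue-snoc : ∀ m as a (xs : Vec ℤ (length as)) y →
  Σ[ zs ∈ Vec ℤ (length (as ++ [ a ])) ] formValue m (as ++ [ a ]) zs ≡ formValue m as xs ℤ.+ + a ℤ.* P m y
formValue-snoc m [] a [] y = y ∷ [] , ℤP.+-comm (+ a ℤ.* P m y) (+ 0)
formValue-snoc m (b ∷ as) a (x ∷ xs) y with formValue-snoc m as a xs y
... | zs , eq = x ∷ zs , trans (cong (ℤ._+_ bx) eq) (sym (ℤP.+-assoc bx (formValue m as xs) (+ a ℤ.* P m y)))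
  where bx = + b ℤ.* P m x

formValue-unsnoc : ∀ m as a (zs : Vec ℤ (length (as ++ [ a ]))) →
  Σ[ xs ∈ Vec ℤ (length as) ] Σ[ y ∈ ℤ ] formValue m (as ++ [ a ]) zs ≡ formValue m as xs ℤ.+ + a ℤ.* P m y
formValue-unsnoc m [] a (y ∷ []) = [] , y , ℤP.+-comm (+ a ℤ.* P m y) (+ 0)
formValue-unsnoc m (b ∷ as) a (x ∷ zs) with formValue-unsnoc m as a zs
... | xs , y , eq = x ∷ xs , y , trans (cong (ℤ._+_ bx) eq) (sym (ℤP.+-assoc bx (formValue m as xs) (+ a ℤ.* P m y)))
  where bx = + b ℤ.* P m x

represents-snoc : ∀ {m n k} as a y → P m y ≡ + k → Represents m as n → Represents m (as ++ [ a ]) (n + a * k)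
represents-snoc {m} {n} {k} as a y Py≡k (xs , xs↦n) with formValue-snoc m as a xs y
... | zs , eq = zs , trans eq (trans (cong₂ (λ u v → u ℤ.+ + a ℤ.* v) xs↦n Py≡k) (pos-+-* n a k))

represents-snoc⁻¹ : ∀ {m n} → 3 ≤ m → ∀ as a → Represents m (as ++ [ a ]) n →
  ∃₂ λ r k → Represents m as r × n ≡ r + a * k
represents-snoc⁻¹ {m} {n} m≥3 as a (zs , zs↦n) with formValue-unsnoc m as a zs
... | xs , y , eq with formValue-natural m≥3 as xs | P-natural m≥3 y
... | r , xs↦r | k , Py≡k = r , k , (xs , xs↦r) , ℤP.+-injective (begin
  + n                                   ≡⟨ sym zs↦n ⟩
  formValue m (as ++ [ a ]) zs          ≡⟨ eq ⟩
  formValue m as xs ℤ.+ + a ℤ.* P m y   ≡⟨ cong₂ (λ u v → u ℤ.+ + a ℤ.* v) xs↦r Py≡k ⟩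
  + r ℤ.+ + a ℤ.* + k                   ≡⟨ pos-+-* r a k ⟩
  + (r + a * k)                         ∎)
  where open ≡-Reasoning

n+a*0≡n : ∀ n a → n + a * 0 ≡ n
n+a*0≡n n a = trans (cong (_+_ n) (*-zeroʳ a)) (+-identityʳ n)

represents-snoc-zero : ∀ {m n} as a → Represents m as n → Represents m (as ++ [ a ]) n
represents-snoc-zero {m} {n} as a n∈as =
  subst (Represents m (as ++ [ a ])) (n+a*0≡n n a) (represents-snoc as a (+ 0) (P-zero m) n∈as)

represents-snoc-one : ∀ {m n} as a → Represents m as n → Represents m (as ++ [ a ]) (n + a)
represents-snoc-one {m} {n} as a n∈as =
  subst (Represents m (as ++ [ a ])) (cong (_+_ n) (*-identityʳ a)) (represents-snoc as a (+ 1) (P-one m) n∈as)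

represents-zero : ∀ m as → Represents m as 0
represents-zero m [] = [] , refl
represents-zero m (a ∷ as) with represents-zero m as
... | xs , xs↦0 = + 0 ∷ xs , trans (cong₂ (λ u v → + a ℤ.* u ℤ.+ v) (P-zero m) xs↦0) (cong (ℤ._+ + 0) (ℤP.*-zeroʳ (+ a)))

represents-<-truant : ∀ {m T n} as → IsTruant m as T → n < T → Represents m as n
represents-<-truant {m} {n = zero} as _                 _   = represents-zero m as
represents-<-truant {n = suc n} _ (_ , _ , below) n<T = below (suc n) (s≤s z≤n) n<T

last-coefficient≤truant : ∀ {m T} → 3 ≤ m → ∀ as a → Represents m (as ++ [ a ]) T → ¬ Represents m as T → a ≤ T
last-coefficient≤truant {m} {T} m≥3 as a T∈as+a T∉as with represents-snoc⁻¹ m≥3 as a T∈as+a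
... | r , zero  , r∈as , T≡r = ⊥-elim (T∉as (subst (Represents m as) (sym (trans T≡r (n+a*0≡n r a))) r∈as))
... | r , suc k , _    , T≡r+a*k = begin
  a             ≤⟨ m≤m*n a (suc k) ⟩
  a * suc k     ≤⟨ m≤n+m _ r ⟩
  r + a * suc k ≡⟨ sym T≡r+a*k ⟩
  T             ∎
  where open ≤-Reasoning

represents-≤-sum : ∀ {m} → 3 ≤ m → ∀ {as} → EscalatorNode m as → ∀ {N} → N ≤ sum as → Represents m as N
represents-≤-sum m≥3 root z≤n = [] , refl
represents-≤-sum {m} m≥3 (child {as} {a} {T} node truant@(_ , T∉as , _) _ T∈as+a) {N} N≤sum
  with <-cmp N T
... | tri< N<T _ _ = represents-snoc-zero as a (represents-<-truant as truant N<T)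
... | tri≈ _ refl _ = T∈as+a
... | tri> _ _ T<N =
  subst (Represents m (as ++ [ a ])) (m∸n+n≡m a≤N) (represents-snoc-one as a (represents-≤-sum m≥3 node N∸a≤sum))
  where
  a≤N : a ≤ N
  a≤N = ≤-trans (last-coefficient≤truant m≥3 as a T∈as+a T∉as) (<⇒≤ T<N)
  N∸a≤sum : N ∸ a ≤ sum as
  N∸a≤sum = m≤n+o⇒m∸n≤o N a (subst (N ≤_) sum-snoc N≤sum)
    where
    sum-snoc : sum (as ++ [ a ]) ≡ a + sum as
    sum-snoc = trans (sum-++ as [ a ]) (trans (cong (_+_ (sum as)) (+-identityʳ a)) (+-comm (sum as) a))

proposition4p1 : (m : ℕ) → 3 ≤ m → (as : List ℕ) → EscalatorNode m as →
                 (N : ℕ) → 1 ≤ N → N ≤ sum as → Represents m as N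
proposition4p1 m m≥3 as node N _ N≤sum = represents-≤-sum m≥3 node N≤sum
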